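{- Let $\mathcal{S}=\langle\mathbf{Fm},\vdash\rangle$ be a logic in which LNC fails. Then its left variable inclusion companion $\mathcal{S}^l$ is strongly paraconsistent. Moreover, if $\mathcal{S}$ is a Hilbert-style logic, then its restricted rules companion $\mathcal{S}^{re}$ is also strongly paraconsistent.
   Context: $\mathbf{Fm}$ is the formula algebra of a logical language (connectives of finite arity, including unary $\neg$ and binary $\land$) over a countably infinite set $V$ of variables, universe $\mathit{Fm}$. A logic is a pair $\langle\mathbf{Fm},\vdash\rangle$ with $\vdash\subseteq\mathcal{P}(\mathit{Fm})\times\mathit{Fm}$ reflexive, transitive and closed under substitutions. $\mathrm{var}(\varphi)$ is the set of variables of $\varphi$, $\mathrm{var}(\Gamma)=\bigcup_{\gamma\in\Gamma}\mathrm{var}(\gamma)$. Left variable inclusion companion $\mathcal{S}^l=\langle\mathbf{Fm},\vdash^l\rangle$: $\Gamma\vdash^l\varphi$ iff there is $\Gamma'\subseteq\Gamma$ with $\mathrm{var}(\Gamma')\subseteq\mathrm{var}(\varphi)$ and $\Gamma'\vdash\varphi$. A Hilbert-style logic is given by schematic sets of axioms and rules $\frac{\Gamma}{\alpha}$, with derivations as finite sequences in the usual way; its restricted rules companion $\mathcal{S}^{re}$ has the same axioms and only the rules $\frac{\Gamma}{\alpha}$ with $\mathrm{var}(\Gamma)\subseteq\mathrm{var}(\alpha)$. In a logic with consequence $\vdash'$: ECQ holds if $\{\alpha,\neg\alpha\}\vdash'\beta$ for all $\alpha,\beta$; LNC holds if $\vdash'\neg(\alpha\land\neg\alpha)$ for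 all $\alpha$; the logic is strongly paraconsistent if both ECQ and LNC fail. -}

module Defs where

open import Level using (Level; 0ℓ; suc)
open import Data.Nat using (ℕ)
open import Data.List using (List; []; _∷_; map)
open import Data.List.Membership.Propositional using () renaming (_∈_ to _∈ᴸ_)
open import Data.List.Relation.Unary.All using (All)
open import Data.Vec using (Vec; []; _∷_)
open import Data.Product using (Σ; ∃; _×_; _,_)
open import Data.Sum using (_⊎_)
open import Relation.Nullary using (¬_)
open import Relation.Unary using (Pred; _∈_; _⊆_; ∅)
open import Relation.Binary.PropositionalEquality using (_≡_)

record Signature : Set₁ where
  field
    Conn : ℕ → Set
    negC : Conn 1
    andC : Conn 2

open Signature

Var : Set
Var = ℕ

data Fm (S : Signature) : Set where
  var : Var → Fm S
  app : ∀ {n} → Conn S n → Vec (Fm S) n → Fm S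

module _ {S : Signature} where

  ¬ᶠ_ : Fm S → Fm S
  ¬ᶠ φ = app (negC S) (φ ∷ [])

  _∧ᶠ_ : Fm S → Fm S → Fm S
  φ ∧ᶠ ψ = app (andC S) (φ ∷ ψ ∷ [])

  mutual
    vars : Fm S → List Var
    vars (var x) = x ∷ []
    vars (app c φs) = varsV φs

    varsV : ∀ {n} → Vec (Fm S) n → List Var
    varsV [] = []
    varsV (φ ∷ φs) = vars φ Data.List.++ varsV φs

  var⟨_⟩ : Fm S → Pred Var 0ℓ
  var⟨ φ ⟩ x = x ∈ᴸ vars φ

  varSet : Pred (Fm S) 0ℓ → Pred Var 0ℓ
  varSet Γ x = Σ (Fm S) λ γ → γ ∈ Γ × x ∈ var⟨ γ ⟩

  Subst : Set
  Subst = Var → Fm S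

  mutual
    sub : Subst → Fm S → Fm S
    sub σ (var x) = σ x
    sub σ (app c φs) = app c (subV σ φs)

    subV : ∀ {n} → Subst → Vec (Fm S) n → Vec (Fm S) n
    subV σ [] = []
    subV σ (φ ∷ φs) = sub σ φ ∷ subV σ φs

  subSet : Subst → Pred (Fm S) 0ℓ → Pred (Fm S) 0ℓ
  subSet σ Γ ψ = Σ (Fm S) λ γ → γ ∈ Γ × ψ ≡ sub σ γ

  Cons : (ℓ : Level) → Set (suc ℓ)
  Cons ℓ = Pred (Fm S) 0ℓ → Fm S → Set ℓ

  ECQ : ∀ {ℓ} → Cons ℓ → Set ℓ
  ECQ _⊢'_ = ∀ α β → (λ ψ → ψ ≡ α ⊎ ψ ≡ ¬ᶠ α) ⊢' β

  LNC : ∀ {ℓ} → Cons ℓ → Set ℓ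
  LNC _⊢'_ = ∀ α → ∅ ⊢' (¬ᶠ (α ∧ᶠ (¬ᶠ α)))

  StronglyParaconsistent : ∀ {ℓ} → Cons ℓ → Set ℓ
  StronglyParaconsistent ⊢' = ¬ ECQ ⊢' × ¬ LNC ⊢'

  leftVarIncl : Cons 0ℓ → Cons (suc 0ℓ)
  leftVarIncl _⊢_ Γ φ =
    Σ (Pred (Fm S) 0ℓ) λ Γ' → Γ' ⊆ Γ × varSet Γ' ⊆ var⟨ φ ⟩ × Γ' ⊢ φ

record Logic (S : Signature) : Set₁ where
  field
    _⊢_    : Pred (Fm S) 0ℓ → Fm S → Set
    reflex : ∀ {Γ φ} → φ ∈ Γ → Γ ⊢ φ
    transi : ∀ {Γ Δ φ} → (∀ {δ} → δ ∈ Δ → Γ ⊢ δ) → Δ ⊢ φ → Γ ⊢ φ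
    struct : ∀ {Γ φ} (σ : Subst) → Γ ⊢ φ → subSet σ Γ ⊢ sub σ φ

-- A Hilbert-style calculus: schematic axioms and schematic rules Γ/α
-- (finitely many premises).  The axioms / rules actually usable are all
-- substitution instances of the given schemata.
record Hilbert (S : Signature) : Set₁ where
  field
    AxiomSchema : Pred (Fm S) 0ℓ
    RuleSchema  : List (Fm S) → Fm S → Set

module _ {S : Signature} where
  open Hilbert

  AxiomInst : Hilbert S → Pred (Fm S) 0ℓ
  AxiomInst H φ = Σ (Fm S) λ α → α ∈ AxiomSchema H × Σ Subst λ σ → φ ≡ sub σ α

  RuleInst : Hilbert S → List (Fm S) → Fm S → Set
  RuleInst H Δ φ = Σ (List (Fm S)) λ Γ → Σ (Fm S) λ α → RuleSchema H Γ α ×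
                   Σ Subst λ σ → Δ ≡ map (sub σ) Γ × φ ≡ sub σ α

  -- Derivations from Γ: finite sequences, stored in reverse order (the head is
  -- the last formula), each entry being a premise, an axiom instance, or the
  -- conclusion of a rule instance whose premises all occur earlier.
  data IsDerivation (H : Hilbert S) (Γ : Pred (Fm S) 0ℓ) : List (Fm S) → Set where
    empty : IsDerivation H Γ []
    step  : ∀ {φ ds} → IsDerivation H Γ ds →
            (φ ∈ Γ ⊎ AxiomInst H φ ⊎
              Σ (List (Fm S)) λ Δ → RuleInst H Δ φ × All (_∈ᴸ ds) Δ) →
            IsDerivation H Γ (φ ∷ ds)

  derivable : Hilbert S → Cons 0ℓ
  derivable H Γ φ = Σ (List (Fm S)) λ ds → IsDerivation H Γ (φ ∷ ds)

  restricted : Hilbert S → Hilbert S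
  restricted H = record
    { AxiomSchema = AxiomSchema H
    ; RuleSchema  = λ Γ α → RuleSchema H Γ α ×
                    (∀ γ x → γ ∈ᴸ Γ → x ∈ var⟨ γ ⟩ → x ∈ var⟨ α ⟩)
    }

-- Both companions only remove inferences from S, so a failure of LNC in S
-- persists in them.  For ECQ, consider {p, ¬p} ⊢ q with distinct variables p
-- and q.  In Sˡ the witnessing Γ' must be empty, because its variables would
-- lie in var(q) = {q}.  In Sʳᵉ a restricted rule never has a premise variable
-- missing from its conclusion, so every formula of a derivation from {p, ¬p}
-- in which p does not occur is already a theorem.  Either way q would be a
-- theorem of S, hence by structurality so would be every ¬(α ∧ ¬α).
module Submission where

open import Defs
open import Data.Product using (_×_)
open import Relation.Nullary using (¬_)

open import Level using (0ℓ)
open import Data.List using (List; []; _∷_; map; _++_)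
open import Data.List.Properties using (map-∘; map-cong)
open import Data.List.Membership.Propositional using () renaming (_∈_ to _∈ᴸ_)
open import Data.List.Membership.Propositional.Properties using (∈-++⁺ˡ; ∈-++⁺ʳ; ∈-++⁻; ∈-map⁺)
open import Data.List.Relation.Unary.All as All using (All; []; _∷_)
open import Data.List.Relation.Unary.All.Properties using (map⁺; map⁻)
open import Data.List.Relation.Unary.Any using (here)
open import Data.Vec using (Vec; []; _∷_)
open import Data.Product using (Σ; _,_)
open import Data.Sum using (_⊎_; inj₁; inj₂)
open import Data.Empty using (⊥-elim)
open import Function using (_∘_)
open import Relation.Unary using (Pred; _∈_; _⊆_; ∅; Satisfiable; _≬_)
open import Relation.Binary.PropositionalEquality using (_≡_; _≢_; refl; sym; trans; cong; cong₂)

module _ {S : Signature} where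

  _∘ˢ_ : Subst {S} → Subst {S} → Subst {S}
  (σ ∘ˢ τ) x = sub σ (τ x)

  mutual
    sub-∘ : (σ τ : Subst {S}) (φ : Fm S) → sub σ (sub τ φ) ≡ sub (σ ∘ˢ τ) φ
    sub-∘ σ τ (var x)    = refl
    sub-∘ σ τ (app c φs) = cong (app c) (subV-∘ σ τ φs)

    subV-∘ : ∀ {n} (σ τ : Subst {S}) (φs : Vec (Fm S) n) → subV σ (subV τ φs) ≡ subV (σ ∘ˢ τ) φs
    subV-∘ σ τ []       = refl
    subV-∘ σ τ (φ ∷ φs) = cong₂ _∷_ (sub-∘ σ τ φ) (subV-∘ σ τ φs)

  map-sub-∘ : (σ τ : Subst {S}) (Γ : List (Fm S)) → map (sub σ) (map (sub τ) Γ) ≡ map (sub (σ ∘ˢ τ)) Γ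
  map-sub-∘ σ τ Γ = trans (sym (map-∘ Γ)) (map-cong (sub-∘ σ τ) Γ)

  mutual
    vars-sub⁻ : (τ : Subst {S}) (φ : Fm S) {x : Var} →
                x ∈ var⟨ sub τ φ ⟩ → Σ Var λ y → y ∈ var⟨ φ ⟩ × x ∈ var⟨ τ y ⟩
    vars-sub⁻ τ (var y)    x∈τy = y , here refl , x∈τy
    vars-sub⁻ τ (app c φs) x∈   = varsV-sub⁻ τ φs x∈

    varsV-sub⁻ : ∀ {n} (τ : Subst {S}) (φs : Vec (Fm S) n) {x : Var} →
                 x ∈ᴸ varsV (subV τ φs) → Σ Var λ y → y ∈ᴸ varsV φs × x ∈ var⟨ τ y ⟩
    varsV-sub⁻ τ (φ ∷ φs) x∈ with ∈-++⁻ (vars (sub τ φ)) x∈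
    ... | inj₁ x∈φ with vars-sub⁻ τ φ x∈φ
    ...   | y , y∈ , x∈τy = y , ∈-++⁺ˡ y∈ , x∈τy
    varsV-sub⁻ τ (φ ∷ φs) x∈ | inj₂ x∈φs with varsV-sub⁻ τ φs x∈φs
    ...   | y , y∈ , x∈τy = y , ∈-++⁺ʳ (vars φ) y∈ , x∈τy

  mutual
    vars-sub⁺ : (τ : Subst {S}) (φ : Fm S) {x y : Var} →
                y ∈ var⟨ φ ⟩ → x ∈ var⟨ τ y ⟩ → x ∈ var⟨ sub τ φ ⟩
    vars-sub⁺ τ (var y)    (here refl) x∈τy = x∈τy
    vars-sub⁺ τ (app c φs) y∈          x∈τy = varsV-sub⁺ τ φs y∈ x∈τy

    varsV-sub⁺ : ∀ {n} (τ : Subst {S}) (φs : Vec (Fm S) n) {x y : Var} →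
                 y ∈ᴸ varsV φs → x ∈ var⟨ τ y ⟩ → x ∈ᴸ varsV (subV τ φs)
    varsV-sub⁺ τ (φ ∷ φs) y∈ x∈τy with ∈-++⁻ (vars φ) y∈
    ... | inj₁ y∈φ  = ∈-++⁺ˡ (vars-sub⁺ τ φ y∈φ x∈τy)
    ... | inj₂ y∈φs = ∈-++⁺ʳ (vars (sub τ φ)) (varsV-sub⁺ τ φs y∈φs x∈τy)

  sub-mono-vars : (τ : Subst {S}) {γ α : Fm S} → var⟨ γ ⟩ ⊆ var⟨ α ⟩ → var⟨ sub τ γ ⟩ ⊆ var⟨ sub τ α ⟩
  sub-mono-vars τ {γ} {α} γ⊆α x∈τγ with vars-sub⁻ τ γ x∈τγ
  ... | y , y∈γ , x∈τy = vars-sub⁺ τ α (γ⊆α y∈γ) x∈τy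

  contradictoryPair : Fm S → Pred (Fm S) 0ℓ
  contradictoryPair α ψ = ψ ≡ α ⊎ ψ ≡ ¬ᶠ α

  contradictoryPair-vars : ∀ {x ψ} → ψ ∈ contradictoryPair (var x) → Satisfiable var⟨ ψ ⟩
  contradictoryPair-vars {x} (inj₁ refl) = x , here refl
  contradictoryPair-vars {x} (inj₂ refl) = x , here refl

  contradictoryPair-apart : ∀ {x y} → x ≢ y → ¬ (var⟨ var {S} y ⟩ ≬ varSet (contradictoryPair (var x)))
  contradictoryPair-apart x≢y (_ , here refl , _ , inj₁ refl , here z≡x) = x≢y (sym z≡x)
  contradictoryPair-apart x≢y (_ , here refl , _ , inj₂ refl , here z≡x) = x≢y (sym z≡x)

module _ {S : Signature} (L : Logic S) where
  open Logic L

  theorem-sub : ∀ {φ} (σ : Subst) → ∅ ⊢ φ → ∅ ⊢ sub σ φ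
  theorem-sub σ ⊢φ = transi (λ { (_ , () , _) }) (struct σ ⊢φ)

  leftVarIncl-apart⇒theorem : ∀ {Γ φ} → (∀ {γ} → γ ∈ Γ → Satisfiable var⟨ γ ⟩) →
                               ¬ (var⟨ φ ⟩ ≬ varSet Γ) → leftVarIncl _⊢_ Γ φ → ∅ ⊢ φ
  leftVarIncl-apart⇒theorem {Γ} {φ} Γ-vars apart (Γ' , Γ'⊆Γ , varsΓ'⊆φ , Γ'⊢φ) = transi Γ'-empty Γ'⊢φ
    where
    Γ'-empty : ∀ {γ} → γ ∈ Γ' → ∅ ⊢ γ
    Γ'-empty γ∈Γ' with Γ-vars (Γ'⊆Γ γ∈Γ')
    ... | x , x∈γ = ⊥-elim (apart (x , varsΓ'⊆φ (_ , γ∈Γ' , x∈γ) , _ , Γ'⊆Γ γ∈Γ' , x∈γ))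

module _ {S : Signature} {H : Hilbert S} where

  IsDerivation-++ : ∀ {Γ ds es} → IsDerivation H Γ es → IsDerivation H Γ ds → IsDerivation H Γ (ds ++ es)
  IsDerivation-++ e empty                                  = e
  IsDerivation-++ e (step d (inj₁ φ∈Γ))                    = step (IsDerivation-++ e d) (inj₁ φ∈Γ)
  IsDerivation-++ e (step d (inj₂ (inj₁ ax)))              = step (IsDerivation-++ e d) (inj₂ (inj₁ ax))
  IsDerivation-++ e (step d (inj₂ (inj₂ (Δ , rule , Δ∈)))) =
    step (IsDerivation-++ e d) (inj₂ (inj₂ (Δ , rule , All.map ∈-++⁺ˡ Δ∈)))

  derivable-collect : ∀ {Γ} (Δ : List (Fm S)) → All (derivable H Γ) Δ →
                      Σ (List (Fm S)) λ es → IsDerivation H Γ es × All (_∈ᴸ es) Δ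
  derivable-collect []      []                = [] , empty , []
  derivable-collect (δ ∷ Δ) ((ds , d) ∷ ⊢Δ) with derivable-collect Δ ⊢Δ
  ... | es , e , Δ∈es = (δ ∷ ds) ++ es , IsDerivation-++ e d , here refl ∷ All.map (∈-++⁺ʳ (δ ∷ ds)) Δ∈es

  derivable-rule : ∀ {Γ Δ φ} → RuleInst H Δ φ → All (derivable H Γ) Δ → derivable H Γ φ
  derivable-rule {Δ = Δ} rule ⊢Δ with derivable-collect Δ ⊢Δ
  ... | es , e , Δ∈es = es , step e (inj₂ (inj₂ (Δ , rule , Δ∈es)))

  IsDerivation-sub : ∀ {Γ Γ′ ds} (σ : Subst) → (∀ {γ} → γ ∈ Γ → sub σ γ ∈ Γ′) →
                     IsDerivation H Γ ds → IsDerivation H Γ′ (map (sub σ) ds)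
  IsDerivation-sub σ σΓ⊆Γ′ empty = empty
  IsDerivation-sub σ σΓ⊆Γ′ (step d (inj₁ φ∈Γ)) =
    step (IsDerivation-sub σ σΓ⊆Γ′ d) (inj₁ (σΓ⊆Γ′ φ∈Γ))
  IsDerivation-sub σ σΓ⊆Γ′ (step d (inj₂ (inj₁ (α , α∈ax , τ , refl)))) =
    step (IsDerivation-sub σ σΓ⊆Γ′ d) (inj₂ (inj₁ (α , α∈ax , σ ∘ˢ τ , sub-∘ σ τ α)))
  IsDerivation-sub σ σΓ⊆Γ′ (step d (inj₂ (inj₂ (_ , (Γs , α , r , τ , refl , refl) , Δ∈ds)))) =
    step (IsDerivation-sub σ σΓ⊆Γ′ d)
         (inj₂ (inj₂ (_ , (Γs , α , r , σ ∘ˢ τ , map-sub-∘ σ τ Γs , sub-∘ σ τ α) ,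
                      map⁺ (All.map (∈-map⁺ (sub σ)) Δ∈ds))))

  derivable-theorem-sub : ∀ {φ} (σ : Subst) → derivable H ∅ φ → derivable H ∅ (sub σ φ)
  derivable-theorem-sub σ (ds , d) = map (sub σ) ds , IsDerivation-sub σ (λ ()) d

module _ {S : Signature} {H : Hilbert S} where

  IsDerivation-restricted⇒ : ∀ {Γ ds} → IsDerivation (restricted H) Γ ds → IsDerivation H Γ ds
  IsDerivation-restricted⇒ empty                     = empty
  IsDerivation-restricted⇒ (step d (inj₁ φ∈Γ))       = step (IsDerivation-restricted⇒ d) (inj₁ φ∈Γ)
  IsDerivation-restricted⇒ (step d (inj₂ (inj₁ ax))) = step (IsDerivation-restricted⇒ d) (inj₂ (inj₁ ax))
  IsDerivation-restricted⇒ (step d (inj₂ (inj₂ (Δ , (Γs , α , (r , _) , τ , eqs) , Δ∈ds)))) =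
    step (IsDerivation-restricted⇒ d) (inj₂ (inj₂ (Δ , (Γs , α , r , τ , eqs) , Δ∈ds)))

  derivable-restricted⇒ : ∀ {Γ φ} → derivable (restricted H) Γ φ → derivable H Γ φ
  derivable-restricted⇒ (ds , d) = ds , IsDerivation-restricted⇒ d

  module _ {Γ : Pred (Fm S) 0ℓ} (Γ-vars : ∀ {γ} → γ ∈ Γ → Satisfiable var⟨ γ ⟩) where

    IsDerivation-restricted-apart : ∀ {ds} → IsDerivation (restricted H) Γ ds →
      All (λ φ → ¬ (var⟨ φ ⟩ ≬ varSet Γ) → derivable (restricted H) ∅ φ) ds
    IsDerivation-restricted-apart empty = []
    IsDerivation-restricted-apart (step {φ} d (inj₁ φ∈Γ)) = premise-overlaps ∷ IsDerivation-restricted-apart d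
      where
      premise-overlaps : ¬ (var⟨ φ ⟩ ≬ varSet Γ) → derivable (restricted H) ∅ φ
      premise-overlaps apart with Γ-vars φ∈Γ
      ... | x , x∈φ = ⊥-elim (apart (x , x∈φ , _ , φ∈Γ , x∈φ))
    IsDerivation-restricted-apart (step d (inj₂ (inj₁ ax))) =
      (λ _ → [] , step empty (inj₂ (inj₁ ax))) ∷ IsDerivation-restricted-apart d
    IsDerivation-restricted-apart
      (step {ds = ds} d (inj₂ (inj₂ (_ , rule@(Γs , α , (_ , premises⊆α) , τ , refl , refl) , Δ∈ds)))) =
      (λ apart → derivable-rule rule (map⁺ (All.tabulate (premise-theorem apart)))) ∷ IH
      where
      IH : All (λ φ → ¬ (var⟨ φ ⟩ ≬ varSet Γ) → derivable (restricted H) ∅ φ) ds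
      IH = IsDerivation-restricted-apart d
      premise-theorem : ¬ (var⟨ sub τ α ⟩ ≬ varSet Γ) → ∀ {γ} → γ ∈ᴸ Γs → derivable (restricted H) ∅ (sub τ γ)
      premise-theorem apart {γ} γ∈Γs = All.lookup IH (All.lookup (map⁻ Δ∈ds) γ∈Γs) τγ-apart
        where
        τγ-apart : ¬ (var⟨ sub τ γ ⟩ ≬ varSet Γ)
        τγ-apart (x , x∈τγ , x∈Γ) = apart (x , sub-mono-vars τ {γ} {α} (premises⊆α γ _ γ∈Γs) x∈τγ , x∈Γ)

    restricted-apart⇒theorem : ∀ {φ} → ¬ (var⟨ φ ⟩ ≬ varSet Γ) →
                               derivable (restricted H) Γ φ → derivable (restricted H) ∅ φ
    restricted-apart⇒theorem apart (_ , d) = All.head (IsDerivation-restricted-apart d) apart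

theorem3p13 : (S : Signature) →
    ((L : Logic S) → ¬ LNC (Logic._⊢_ L) →
      StronglyParaconsistent (leftVarIncl (Logic._⊢_ L)))
    ×
    ((H : Hilbert S) → ¬ LNC (derivable H) →
      StronglyParaconsistent (derivable (restricted H)))
theorem3p13 S = leftVarIncl-paraconsistent , restricted-paraconsistent
  where
  toLNC : Fm S → Subst {S}
  toLNC α _ = ¬ᶠ (α ∧ᶠ (¬ᶠ α))

  q-apart : ¬ (var⟨ var {S} 1 ⟩ ≬ varSet (contradictoryPair (var 0)))
  q-apart = contradictoryPair-apart λ ()

  leftVarIncl-paraconsistent : (L : Logic S) → ¬ LNC (Logic._⊢_ L) →
                               StronglyParaconsistent (leftVarIncl (Logic._⊢_ L))
  leftVarIncl-paraconsistent L ¬lnc =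
      (λ ecq → ¬lnc λ α → theorem-sub L (toLNC α)
                 (leftVarIncl-apart⇒theorem L contradictoryPair-vars q-apart (ecq (var 0) (var 1))))
    , (λ lnc′ → ¬lnc λ α → leftVarIncl-apart⇒theorem L (λ ()) (λ { (_ , _ , _ , () , _) }) (lnc′ α))

  restricted-paraconsistent : (H : Hilbert S) → ¬ LNC (derivable H) →
                              StronglyParaconsistent (derivable (restricted H))
  restricted-paraconsistent H ¬lnc =
      (λ ecq → ¬lnc λ α → derivable-restricted⇒ (derivable-theorem-sub (toLNC α)
                 (restricted-apart⇒theorem contradictoryPair-vars q-apart (ecq (var 0) (var 1)))))
    , (λ lnc′ → ¬lnc (derivable-restricted⇒ ∘ lnc′))
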